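{- Let $q$ be a prime power, $n$ a positive integer, $L_1,L_2$ permutation $q$-polynomials over $\mathbb{F}_{q^n}$ and $\rho\in\mathrm{Aut}(\mathbb{F}_q)$. If \[\{ax: a\in\mathbb{F}_{q^n}\}=\{L_1(a^\rho L_2(x)) : a\in\mathbb{F}_{q^n}\},\] then $L_1(x)=cx^{q^r}$ and $L_2(x)=dx^{q^{n-r}}$ for some integer $r$ and some $c,d\in\mathbb{F}_{q^n}^*$.
   Context: A $q$-polynomial over $\mathbb{F}_{q^n}$ is $\sum_{i=0}^{n-1}a_ix^{q^i}$ with $a_i\in\mathbb{F}_{q^n}$, considered modulo $x^{q^n}-x$; it is a permutation $q$-polynomial if it induces a bijection of $\mathbb{F}_{q^n}$. Polynomials are compared as elements of $\mathbb{F}_{q^n}[x]/(x^{q^n}-x)$. -}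

module Defs where

open import Data.Nat using (ℕ; zero; suc; _^_; _≥_; _∸_; _%_; NonZero)
open import Data.Nat.Primality using (Prime)
open import Data.Fin using (Fin; toℕ)
open import Data.Vec using (Vec; lookup)
open import Data.Product using (Σ; ∃; _×_)
open import Relation.Binary.PropositionalEquality using (_≡_; _≢_)
open import Relation.Nullary using (¬_)
open import Algebra.Structures using (IsCommutativeRing)
open import Function.Definitions using (Bijective)

IsPrimePower : ℕ → Set
IsPrimePower q = Σ ℕ λ p → Σ ℕ λ k → Prime p × k ≥ 1 × q ≡ p ^ k

record FiniteField (N : ℕ) : Set₁ where
  infixl 6 _+_
  infixl 7 _*_
  field
    F       : Set
    _+_ _*_ : F → F → F
    -_      : F → F
    0# 1#   : F
    isCommutativeRing : IsCommutativeRing _≡_ _+_ _*_ -_ 0# 1#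
    0≢1     : 0# ≢ 1#
    inverse : ∀ x → x ≢ 0# → Σ F λ y → x * y ≡ 1#
    enum    : Fin N → F
    enum-bij : Bijective _≡_ _≡_ enum

  pow : F → ℕ → F
  pow x zero    = 1#
  pow x (suc k) = x * pow x k

  sumFin : ∀ {m} → (Fin m → F) → F
  sumFin {zero}  f = 0#
  sumFin {suc m} f = f Fin.zero + sumFin {m} (λ i → f (Fin.suc i))
    where import Data.Fin as Fin

  -- A q-polynomial over F_{q^n} reduced modulo x^{q^n} - x:
  -- coefficient vector (a_0 , … , a_{n-1}) representing Σ a_i x^{q^i}.
  QPoly : ℕ → ℕ → Set
  QPoly q n = Vec F n

  evalQ : ∀ q {n} → Vec F n → F → F
  evalQ q {n} L x = sumFin {n} (λ i → lookup L i * pow x (q ^ toℕ i))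

  IsPermQPoly : ∀ q {n} → Vec F n → Set
  IsPermQPoly q L = Bijective _≡_ _≡_ (evalQ q L)

  IsAutomorphism : (F → F) → Set
  IsAutomorphism ρ = Bijective _≡_ _≡_ ρ
                   × (∀ a b → ρ (a + b) ≡ ρ a + ρ b)
                   × (∀ a b → ρ (a * b) ≡ ρ a * ρ b)
                   × ρ 1# ≡ 1#

  -- the reduced q-polynomial c x^{q^r}, r ∈ {0,…,n-1}: coefficient c at
  -- position r and 0 elsewhere
  IsMonomial : ∀ {n} → Vec F n → Fin n → F → Set
  IsMonomial L r c = ∀ i → (i ≡ r → lookup L i ≡ c) × (¬ (i ≡ r) → lookup L i ≡ 0#)

negFin : ∀ {n} → Fin n → Fin n
negFin {suc m} r = fromℕ< (m%n<n (suc m ∸ toℕ r) (suc m))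
  where
    open import Data.Fin using (fromℕ<)
    open import Data.Nat.DivMod using (m%n<n)

module Submission where

-- Writing Φₑ(x) = x^(q^e), a q-polynomial is the linear combination
-- Σ Lᵢ Φᵢ of the characters Φ₀, …, Φ_{n-1}.  From the hypothesis with a = 1
-- we get β with L₁(β L₂(x)) = x; it follows that both L₁ and L₂ are
-- homogeneous under scaling, L(t y) = A_t L(y).  By Dedekind's independence
-- of distinct characters a nonzero homogeneous q-polynomial is a monomial.
-- Substituting the monomials back gives Φ_{r₂+r₁} = id, whence r₂ + r₁ is 0
-- or n.

open import Defs
open import Level using (0ℓ)
open import Data.Nat as ℕ using (ℕ; zero; suc; _^_; _≥_; _≤_; _<_; z≤n; s≤s)
open import Data.Nat.DivMod using (n%n≡0; m<n⇒m%n≡m)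
open import Data.Nat.Primality using (prime⇒nonZero; prime⇒nonTrivial)
open import Data.Fin as Fin using (Fin; toℕ; punchIn)
import Data.Fin.Properties as FinP
import Data.Nat.Properties as ℕP
open import Data.Fin.Permutation using (Permutation; permutation)
open import Data.Vec using (Vec; []; _∷_; lookup; replicate; _++_)
open import Data.Product using (Σ; _×_; _,_; proj₁; proj₂)
open import Data.Sum using (_⊎_; inj₁; inj₂)
open import Data.Empty using (⊥-elim)
open import Relation.Binary.Definitions using (tri<; tri≈; tri>)
open import Relation.Nullary using (Dec; yes; no)
open import Relation.Binary.PropositionalEquality
  using (_≡_; _≢_; refl; sym; trans; cong; cong₂; subst; module ≡-Reasoning)
open import Algebra.Bundles using (CommutativeMonoid; CommutativeRing)
open import Function.Bundles using (mk↣)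
open import Function.Definitions using (Injective; Surjective; Bijective)
import Algebra.Properties.CommutativeMonoid.Sum as MonoidSum

module SingleTerm {c ℓ} (M : CommutativeMonoid c ℓ) where
  open CommutativeMonoid M
  open MonoidSum M
  open import Relation.Binary.Reasoning.Setoid setoid

  sum-single : ∀ {m} (f : Fin m → Carrier) (r : Fin m) →
               (∀ i → i ≢ r → f i ≈ ε) → sum f ≈ f r
  sum-single {suc m} f r others = begin
    sum f                               ≈⟨ sum-remove {i = r} f ⟩
    f r ∙ sum (λ j → f (punchIn r j))   ≈⟨ ∙-congˡ (sum-cong-≋ (λ j → others _ (FinP.punchInᵢ≢i r j))) ⟩
    f r ∙ sum {m} (λ _ → ε)             ≈⟨ ∙-congˡ (sum-replicate-zero m) ⟩
    f r ∙ ε                             ≈⟨ identityʳ (f r) ⟩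
    f r                                 ∎

module FieldFacts {N : ℕ} (K : FiniteField N) where
  open FiniteField K
  ring : CommutativeRing 0ℓ 0ℓ
  ring = record { isCommutativeRing = isCommutativeRing }
  open CommutativeRing ring public
    using (+-assoc; +-identityˡ; +-identityʳ; *-assoc; *-comm;
           *-identityˡ; *-identityʳ; distribˡ; distribʳ; zeroˡ; zeroʳ;
           +-commutativeMonoid; *-commutativeMonoid; +-group;
           commutativeSemiring; -‿inverseˡ)
  open import Algebra.Properties.Ring (CommutativeRing.ring ring) public using (-‿distribʳ-*)
  open import Algebra.Properties.Group +-group public
    using (∙-cancelˡ; identityˡ-unique; x∙y⁻¹≈ε⇒x≈y)
  module Σ+ = MonoidSum +-commutativeMonoid
  module Π* = MonoidSum *-commutativeMonoid
  open import Algebra.Solver.Ring.NaturalCoefficients.Default commutativeSemiring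
    using (solve; _:+_; _:*_; _:=_; con)
  open ≡-Reasoning

  prod : ∀ {m} → (Fin m → F) → F
  prod = Π*.sum

  index : F → Fin N
  index y = proj₁ (proj₂ enum-bij y)

  enum-index : ∀ y → enum (index y) ≡ y
  enum-index y = proj₂ (proj₂ enum-bij y) refl

  index-enum : ∀ k → index (enum k) ≡ k
  index-enum k = proj₁ enum-bij (enum-index (enum k))

  _≟_ : (x y : F) → Dec (x ≡ y)
  _≟_ = FinP.inj⇒≟ (mk↣ {to = index} (λ {x} {y} e →
          trans (sym (enum-index x)) (trans (cong enum e) (enum-index y))))

  inv : (x : F) → x ≢ 0# → F
  inv x x≢0 = proj₁ (inverse x x≢0)

  inv-cancelˡ : ∀ x (x≢0 : x ≢ 0#) y → inv x x≢0 * (x * y) ≡ y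
  inv-cancelˡ x x≢0 y = begin
    x⁻¹ * (x * y)   ≡⟨ sym (*-assoc x⁻¹ x y) ⟩
    (x⁻¹ * x) * y   ≡⟨ cong (_* y) (trans (*-comm x⁻¹ x) (proj₂ (inverse x x≢0))) ⟩
    1# * y          ≡⟨ *-identityˡ y ⟩
    y               ∎
    where
    x⁻¹ : F
    x⁻¹ = inv x x≢0

  inv-cancelʳ : ∀ x (x≢0 : x ≢ 0#) y → x * (inv x x≢0 * y) ≡ y
  inv-cancelʳ x x≢0 y = begin
    x * (x⁻¹ * y)   ≡⟨ sym (*-assoc x x⁻¹ y) ⟩
    (x * x⁻¹) * y   ≡⟨ cong (_* y) (proj₂ (inverse x x≢0)) ⟩
    1# * y          ≡⟨ *-identityˡ y ⟩
    y               ∎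
    where
    x⁻¹ : F
    x⁻¹ = inv x x≢0

  *-cancelˡ : ∀ {x y z} → x ≢ 0# → x * y ≡ x * z → y ≡ z
  *-cancelˡ {x} {y} {z} x≢0 xy≡xz = begin
    y                    ≡⟨ sym (inv-cancelˡ x x≢0 y) ⟩
    inv x x≢0 * (x * y)  ≡⟨ cong (inv x x≢0 *_) xy≡xz ⟩
    inv x x≢0 * (x * z)  ≡⟨ inv-cancelˡ x x≢0 z ⟩
    z                    ∎

  *-nonzero : ∀ {x y} → x ≢ 0# → y ≢ 0# → x * y ≢ 0#
  *-nonzero {x} x≢0 y≢0 xy≡0 = y≢0 (*-cancelˡ x≢0 (trans xy≡0 (sym (zeroʳ x))))

  scalar-zero : ∀ {c u v} → c * u ≡ c * v → u ≢ v → c ≡ 0#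
  scalar-zero {c} cu≡cv u≢v with c ≟ 0#
  ... | yes c≡0 = c≡0
  ... | no  c≢0 = ⊥-elim (u≢v (*-cancelˡ c≢0 cu≡cv))

  pow-+ : ∀ x a b → pow x (a ℕ.+ b) ≡ pow x a * pow x b
  pow-+ x zero    b = sym (*-identityˡ _)
  pow-+ x (suc a) b = trans (cong (x *_) (pow-+ x a b)) (sym (*-assoc x _ _))

  pow-*-distrib : ∀ x y a → pow (x * y) a ≡ pow x a * pow y a
  pow-*-distrib x y zero    = sym (*-identityˡ 1#)
  pow-*-distrib x y (suc a) = begin
    (x * y) * pow (x * y) a         ≡⟨ cong ((x * y) *_) (pow-*-distrib x y a) ⟩
    (x * y) * (pow x a * pow y a)   ≡⟨ solve 4 (λ x y u v → (x :* y) :* (u :* v) := (x :* u) :* (y :* v))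
                                           refl x y (pow x a) (pow y a) ⟩
    (x * pow x a) * (y * pow y a)   ∎

  pow-* : ∀ x a b → pow x (a ℕ.* b) ≡ pow (pow x a) b
  pow-* x a zero    = cong (pow x) (ℕP.*-zeroʳ a)
  pow-* x a (suc b) = begin
    pow x (a ℕ.* suc b)           ≡⟨ cong (pow x) (ℕP.*-suc a b) ⟩
    pow x (a ℕ.+ a ℕ.* b)         ≡⟨ pow-+ x a (a ℕ.* b) ⟩
    pow x a * pow x (a ℕ.* b)     ≡⟨ cong (pow x a *_) (pow-* x a b) ⟩
    pow x a * pow (pow x a) b     ∎

  pow-1# : ∀ a → pow 1# a ≡ 1#
  pow-1# zero    = refl
  pow-1# (suc a) = trans (*-identityˡ _) (pow-1# a)

  pow-0# : ∀ a → 0 < a → pow 0# a ≡ 0#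
  pow-0# (suc a) _ = zeroˡ _

  sumFin≡sum : ∀ {m} (f : Fin m → F) → sumFin f ≡ Σ+.sum f
  sumFin≡sum {zero}  f = refl
  sumFin≡sum {suc m} f = cong (f Fin.zero +_) (sumFin≡sum (λ i → f (Fin.suc i)))

  sumFin-cong : ∀ {m} {f g : Fin m → F} → (∀ i → f i ≡ g i) → sumFin f ≡ sumFin g
  sumFin-cong {f = f} {g} f≗g =
    trans (sumFin≡sum f) (trans (Σ+.sum-cong-≗ f≗g) (sym (sumFin≡sum g)))

  sumFin-+ : ∀ {m} (f g : Fin m → F) → sumFin (λ i → f i + g i) ≡ sumFin f + sumFin g
  sumFin-+ f g = trans (sumFin≡sum (λ i → f i + g i)) (trans (Σ+.∑-distrib-+ f g)
                   (sym (cong₂ _+_ (sumFin≡sum f) (sumFin≡sum g))))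

  sumFin-scale : ∀ {m} c (f : Fin m → F) → c * sumFin f ≡ sumFin (λ i → c * f i)
  sumFin-scale c f = trans (cong (c *_) (sumFin≡sum f))
                       (trans (*-distribˡ-sum c f) (sym (sumFin≡sum (λ i → c * f i))))
    where open import Algebra.Properties.Semiring.Sum (CommutativeRing.semiring ring)
            using (*-distribˡ-sum)

  sumFin-zero : ∀ {m} (f : Fin m → F) → (∀ i → f i ≡ 0#) → sumFin f ≡ 0#
  sumFin-zero {m} f f≡0 = trans (sumFin≡sum f) (trans (Σ+.sum-cong-≗ f≡0) (Σ+.sum-replicate-zero m))

  sumFin-single : ∀ {m} (f : Fin m → F) (r : Fin m) → (∀ i → i ≢ r → f i ≡ 0#) →
                  sumFin f ≡ f r
  sumFin-single f r others = trans (sumFin≡sum f) (SingleTerm.sum-single +-commutativeMonoid f r others)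

  ∏ : (F → F) → F
  ∏ f = prod (λ k → f (enum k))

  ∏-cong : ∀ {f g : F → F} → (∀ x → f x ≡ g x) → ∏ f ≡ ∏ g
  ∏-cong f≗g = Π*.sum-cong-≗ (λ k → f≗g (enum k))

  ∏-distrib : ∀ (f g : F → F) → ∏ (λ x → f x * g x) ≡ ∏ f * ∏ g
  ∏-distrib f g = Π*.∑-distrib-+ (λ k → f (enum k)) (λ k → g (enum k))

  ∏-const : ∀ a → ∏ (λ _ → a) ≡ pow a N
  ∏-const a = prod-const N
    where
    prod-const : ∀ m → prod {m} (λ _ → a) ≡ pow a m
    prod-const zero    = refl
    prod-const (suc m) = cong (a *_) (prod-const m)

  prod-nonzero : ∀ {m} (f : Fin m → F) → (∀ i → f i ≢ 0#) → prod f ≢ 0#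
  prod-nonzero {zero}  f f≢0 = λ 1≡0 → 0≢1 (sym 1≡0)
  prod-nonzero {suc m} f f≢0 = *-nonzero (f≢0 Fin.zero) (prod-nonzero (λ i → f (Fin.suc i)) (λ i → f≢0 (Fin.suc i)))

  ∏-reindex : (f σ σ⁻¹ : F → F) → (∀ y → σ (σ⁻¹ y) ≡ y) → (∀ y → σ⁻¹ (σ y) ≡ y) →
              ∏ f ≡ ∏ (λ x → f (σ x))
  ∏-reindex f σ σ⁻¹ σσ⁻¹ σ⁻¹σ =
    trans (Π*.sum-permute (λ k → f (enum k)) π) (Π*.sum-cong-≗ {N} (λ k → cong f (enum-index (σ (enum k)))))
    where
    transport : (F → F) → Fin N → Fin N
    transport τ k = index (τ (enum k))
    transport-inverse : (τ τ′ : F → F) → (∀ y → τ (τ′ y) ≡ y) → ∀ k → transport τ (transport τ′ k) ≡ k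
    transport-inverse τ τ′ ττ′ k = begin
      index (τ (enum (index (τ′ (enum k)))))  ≡⟨ cong (λ y → index (τ y)) (enum-index _) ⟩
      index (τ (τ′ (enum k)))                 ≡⟨ cong index (ττ′ (enum k)) ⟩
      index (enum k)                          ≡⟨ index-enum k ⟩
      k                                       ∎
    π : Permutation N N
    π = permutation (transport σ) (transport σ⁻¹)
          (transport-inverse σ σ⁻¹ σσ⁻¹) (transport-inverse σ⁻¹ σ σ⁻¹σ)

  nonzeroPart : F → F
  nonzeroPart x with x ≟ 0#
  ... | yes _ = 1#
  ... | no  _ = x

  zeroWeight : F → F → F
  zeroWeight a x with x ≟ 0#
  ... | yes _ = a
  ... | no  _ = 1#

  nonzeroPart≢0 : ∀ x → nonzeroPart x ≢ 0#
  nonzeroPart≢0 x with x ≟ 0#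
  ... | yes _   = λ 1≡0 → 0≢1 (sym 1≡0)
  ... | no  x≢0 = x≢0

  nonzeroPart-scale : ∀ a x → a ≢ 0# → nonzeroPart (a * x) * zeroWeight a x ≡ a * nonzeroPart x
  nonzeroPart-scale a x a≢0 with x ≟ 0# | (a * x) ≟ 0#
  ... | yes _   | yes _    = trans (*-identityˡ a) (sym (*-identityʳ a))
  ... | yes x≡0 | no  ax≢0 = ⊥-elim (ax≢0 (trans (cong (a *_) x≡0) (zeroʳ a)))
  ... | no  x≢0 | yes ax≡0 = ⊥-elim (*-nonzero a≢0 x≢0 ax≡0)
  ... | no  _   | no  _    = *-identityʳ _

  ∏-zeroWeight : ∀ a → ∏ (zeroWeight a) ≡ a
  ∏-zeroWeight a = trans (SingleTerm.sum-single *-commutativeMonoid _ (index 0#) weight-one)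
                         (trans (cong (zeroWeight a) (enum-index 0#)) weight-zero)
    where
    weight-zero : zeroWeight a 0# ≡ a
    weight-zero with 0# ≟ 0#
    ... | yes _  = refl
    ... | no 0≢0 = ⊥-elim (0≢0 refl)
    weight-one : ∀ k → k ≢ index 0# → zeroWeight a (enum k) ≡ 1#
    weight-one k k≢0 with enum k ≟ 0#
    ... | yes e≡0 = ⊥-elim (k≢0 (trans (sym (index-enum k)) (cong index e≡0)))
    ... | no  _   = refl

  -- For
  -- a ≢ 0# the substitution x ↦ a x permutes F, so with P the product of
  -- the nonzero parts of all elements, P · a = a^N · P; the weight at 0#
  -- accounts for the one factor a that the element 0# contributes.
  fermat-nonzero : ∀ a → a ≢ 0# → pow a N ≡ a
  fermat-nonzero a a≢0 = sym (*-cancelˡ P≢0 (begin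
    P * a                                             ≡⟨ cong (P *_) (sym (∏-zeroWeight a)) ⟩
    P * ∏ (zeroWeight a)                              ≡⟨ cong (_* ∏ (zeroWeight a)) (∏-reindex nonzeroPart (a *_) (inv a a≢0 *_)
                                                           (inv-cancelʳ a a≢0) (inv-cancelˡ a a≢0)) ⟩
    ∏ (λ x → nonzeroPart (a * x)) * ∏ (zeroWeight a) ≡⟨ sym (∏-distrib (λ x → nonzeroPart (a * x)) (zeroWeight a)) ⟩
    ∏ (λ x → nonzeroPart (a * x) * zeroWeight a x)   ≡⟨ ∏-cong (λ x → nonzeroPart-scale a x a≢0) ⟩
    ∏ (λ x → a * nonzeroPart x)                       ≡⟨ ∏-distrib (λ _ → a) nonzeroPart ⟩
    ∏ (λ _ → a) * P                                   ≡⟨ cong (_* P) (∏-const a) ⟩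
    pow a N * P                                       ≡⟨ *-comm _ P ⟩
    P * pow a N                                       ∎))
    where
    P : F
    P = ∏ nonzeroPart
    P≢0 : P ≢ 0#
    P≢0 = prod-nonzero _ (λ k → nonzeroPart≢0 (enum k))

  fermat : ∀ x → pow x N ≡ x
  fermat x with x ≟ 0#
  ... | no  x≢0 = fermat-nonzero x x≢0
  ... | yes x≡0 = trans (cong (λ y → pow y N) x≡0)
                    (trans (pow-0# N (ℕP.≤-<-trans z≤n (FinP.toℕ<n (index 0#)))) (sym x≡0))

  -- A monic polynomial c₀ + c₁ x + ⋯ + c_{d-1} x^{d-1} + x^d, given by its
  -- lower coefficients and evaluated by Horner's rule.
  evalMonic : ∀ {d} → Vec F d → F → F
  evalMonic []       x = 1#
  evalMonic (c ∷ cs) x = c + x * evalMonic cs x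

  -- Synthetic division of a monic polynomial by x - a.
  quotient : ∀ {d} → F → Vec F (suc d) → Vec F d
  quotient a (c ∷ [])      = []
  quotient a (c ∷ c′ ∷ cs) = evalMonic (c′ ∷ cs) a ∷ quotient a (c′ ∷ cs)

  -- Factor theorem P(x) - P(a) = (x - a) Q(x), stated without subtraction.
  factor-theorem : ∀ {d} a (cs : Vec F (suc d)) x →
    evalMonic cs x + a * evalMonic (quotient a cs) x ≡ x * evalMonic (quotient a cs) x + evalMonic cs a
  factor-theorem a (c ∷ []) x =
    solve 3 (λ c a x → (c :+ x :* con 1) :+ a :* con 1 := x :* con 1 :+ (c :+ a :* con 1)) refl c a x
  factor-theorem a (c ∷ c′ ∷ cs) x = begin
    (c + x * S) + a * (r + x * Q)   ≡⟨ solve 6 (λ c a x S r Q → (c :+ x :* S) :+ a :* (r :+ x :* Q)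
                                              := (c :+ a :* r) :+ x :* (S :+ a :* Q)) refl c a x S r Q ⟩
    (c + a * r) + x * (S + a * Q)   ≡⟨ cong (λ y → (c + a * r) + x * y) (factor-theorem a (c′ ∷ cs) x) ⟩
    (c + a * r) + x * (x * Q + r)   ≡⟨ solve 5 (λ c a x r Q → (c :+ a :* r) :+ x :* (x :* Q :+ r)
                                              := x :* (r :+ x :* Q) :+ (c :+ a :* r)) refl c a x r Q ⟩
    x * (r + x * Q) + (c + a * r)   ∎
    where
    S Q r : F
    S = evalMonic (c′ ∷ cs) x
    Q = evalMonic (quotient a (c′ ∷ cs)) x
    r = evalMonic (c′ ∷ cs) a

  roots-bound : ∀ {d m} (cs : Vec F d) (v : Fin m → F) → Injective _≡_ _≡_ v →
                (∀ i → evalMonic cs (v i) ≡ 0#) → m ≤ d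
  roots-bound {m = zero}  cs       v v-inj roots = z≤n
  roots-bound {m = suc m} []       v v-inj roots = ⊥-elim (0≢1 (sym (roots Fin.zero)))
  roots-bound {m = suc m} (c ∷ cs) v v-inj roots =
    s≤s (roots-bound (quotient a (c ∷ cs)) (λ i → v (Fin.suc i))
                     (λ e → FinP.suc-injective (v-inj e)) quotient-roots)
    where
    a : F
    a = v Fin.zero
    quotient-roots : ∀ i → evalMonic (quotient a (c ∷ cs)) (v (Fin.suc i)) ≡ 0#
    quotient-roots i = scalar-zero (begin
      Q * a          ≡⟨ *-comm Q a ⟩
      a * Q          ≡⟨ sym (+-identityˡ _) ⟩
      0# + a * Q     ≡⟨ cong (_+ a * Q) (sym (roots (Fin.suc i))) ⟩
      evalMonic (c ∷ cs) b + a * Q   ≡⟨ factor-theorem a (c ∷ cs) b ⟩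
      b * Q + evalMonic (c ∷ cs) a   ≡⟨ cong (b * Q +_) (roots Fin.zero) ⟩
      b * Q + 0#     ≡⟨ +-identityʳ _ ⟩
      b * Q          ≡⟨ *-comm b Q ⟩
      Q * b          ∎) (λ a≡b → FinP.0≢1+n (v-inj a≡b))
      where
      b Q : F
      b = v (Fin.suc i)
      Q = evalMonic (quotient a (c ∷ cs)) b

  evalMonic-zeros : ∀ k x → evalMonic (replicate k 0#) x ≡ pow x k
  evalMonic-zeros zero    x = refl
  evalMonic-zeros (suc k) x = trans (+-identityˡ _) (cong (x *_) (evalMonic-zeros k x))

  evalMonic-shift : ∀ a {d} (cs : Vec F d) x → evalMonic (replicate a 0# ++ cs) x ≡ pow x a * evalMonic cs x
  evalMonic-shift zero    cs x = sym (*-identityˡ _)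
  evalMonic-shift (suc a) cs x = begin
    0# + x * evalMonic (replicate a 0# ++ cs) x   ≡⟨ +-identityˡ _ ⟩
    x * evalMonic (replicate a 0# ++ cs) x        ≡⟨ cong (x *_) (evalMonic-shift a cs x) ⟩
    x * (pow x a * evalMonic cs x)                ≡⟨ sym (*-assoc x _ _) ⟩
    (x * pow x a) * evalMonic cs x                ∎

  -- If x^a = x^b for every x, with a < b, then every element is a root of the
  -- monic polynomial x^b - x^a, so the field has at most b elements.
  powers-coincide-bound : ∀ a b → a < b → (∀ x → pow x a ≡ pow x b) → N ≤ b
  powers-coincide-bound a b a<b same =
    subst (N ≤_) degree (roots-bound cs enum (proj₁ enum-bij) (λ i → root (enum i)))
    where
    k : ℕ
    k = b ℕ.∸ suc a
    degree : a ℕ.+ suc k ≡ b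
    degree = trans (ℕP.+-suc a k) (ℕP.m+[n∸m]≡n a<b)
    cs : Vec F (a ℕ.+ suc k)
    cs = replicate a 0# ++ (- 1# ∷ replicate k 0#)
    root : ∀ x → evalMonic cs x ≡ 0#
    root x = begin
      evalMonic cs x                               ≡⟨ evalMonic-shift a _ x ⟩
      pow x a * (- 1# + x * evalMonic (replicate k 0#) x)
                                                   ≡⟨ cong (λ y → pow x a * (- 1# + x * y)) (evalMonic-zeros k x) ⟩
      pow x a * (- 1# + pow x (suc k))             ≡⟨ distribˡ (pow x a) (- 1#) _ ⟩
      pow x a * - 1# + pow x a * pow x (suc k)     ≡⟨ cong₂ _+_ (sym (-‿distribʳ-* (pow x a) 1#)) (sym (pow-+ x a (suc k))) ⟩
      - (pow x a * 1#) + pow x (a ℕ.+ suc k)       ≡⟨ cong₂ (λ u v → - u + v) (*-identityʳ _)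
                                                        (trans (cong (pow x) degree) (sym (same x))) ⟩
      - pow x a + pow x a                          ≡⟨ -‿inverseˡ (pow x a) ⟩
      0#                                           ∎

  combination-difference : ∀ {m} (a b u : Fin m → F) →
    sumFin (λ i → a i * u i) ≡ sumFin (λ i → b i * u i) →
    sumFin (λ i → (a i + - b i) * u i) ≡ 0#
  combination-difference a b u same = identityˡ-unique _ _ (begin
    sumFin (λ i → (a i + - b i) * u i) + sumFin (λ i → b i * u i)
      ≡⟨ sym (sumFin-+ (λ i → (a i + - b i) * u i) (λ i → b i * u i)) ⟩
    sumFin (λ i → (a i + - b i) * u i + b i * u i)
      ≡⟨ sumFin-cong (λ i → trans (sym (distribʳ (u i) _ (b i))) (cong (_* u i) (difference-cancel (a i) (b i)))) ⟩
    sumFin (λ i → a i * u i)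
      ≡⟨ same ⟩
    sumFin (λ i → b i * u i) ∎)
    where
    difference-cancel : ∀ x y → (x + - y) + y ≡ x
    difference-cancel x y = begin
      (x + - y) + y   ≡⟨ +-assoc x (- y) y ⟩
      x + (- y + y)   ≡⟨ cong (x +_) (-‿inverseˡ y) ⟩
      x + 0#          ≡⟨ +-identityʳ x ⟩
      x               ∎

  record DistinctCharacters (m : ℕ) : Set where
    field
      χ          : Fin m → F → F
      χ-mul      : ∀ i x y → χ i (x * y) ≡ χ i x * χ i y
      χ-one      : ∀ i → χ i 1# ≡ 1#
      χ-distinct : ∀ i j → i ≢ j → Σ F λ y → χ i y ≢ χ j y

  dropFirst : ∀ {m} → DistinctCharacters (suc m) → DistinctCharacters m
  dropFirst X = record
    { χ          = λ j → χ (Fin.suc j)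
    ; χ-mul      = λ j → χ-mul (Fin.suc j)
    ; χ-one      = λ j → χ-one (Fin.suc j)
    ; χ-distinct = λ i j i≢j → χ-distinct (Fin.suc i) (Fin.suc j) (λ e → i≢j (FinP.suc-injective e))
    }
    where open DistinctCharacters X

  -- Comparing the relation at y * x with χ₀(y) times the relation at x
  -- eliminates χ₀; by induction the new coefficients cᵢ (χᵢ(y) - χ₀(y))
  -- vanish, and choosing y with χᵢ(y) ≢ χ₀(y) gives cᵢ = 0 for i > 0.
  characters-independent : ∀ {m} (X : DistinctCharacters m) (c : Fin m → F) →
    (∀ x → sumFin (λ i → c i * DistinctCharacters.χ X i x) ≡ 0#) → ∀ i → c i ≡ 0#
  characters-independent {suc m} X c relation = coefficient
    where
    open DistinctCharacters X
    c′ : Fin m → F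
    c′ j = c (Fin.suc j)
    χ′ : Fin m → F → F
    χ′ j = χ (Fin.suc j)

    eliminate-χ₀ : ∀ y x → sumFin (λ j → (c′ j * χ′ j y) * χ′ j x) ≡ sumFin (λ j → (χ Fin.zero y * c′ j) * χ′ j x)
    eliminate-χ₀ y x = ∙-cancelˡ ((c Fin.zero * χ Fin.zero y) * χ Fin.zero x) _ _ (begin
      (c Fin.zero * χ Fin.zero y) * χ Fin.zero x + sumFin (λ j → (c′ j * χ′ j y) * χ′ j x)
        ≡⟨ at-product ⟩
      0#
        ≡⟨ sym scaled ⟩
      (χ Fin.zero y * c Fin.zero) * χ Fin.zero x + sumFin (λ j → (χ Fin.zero y * c′ j) * χ′ j x)
        ≡⟨ cong (λ u → u * χ Fin.zero x + sumFin (λ j → (χ Fin.zero y * c′ j) * χ′ j x)) (*-comm (χ Fin.zero y) (c Fin.zero)) ⟩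
      (c Fin.zero * χ Fin.zero y) * χ Fin.zero x + sumFin (λ j → (χ Fin.zero y * c′ j) * χ′ j x) ∎)
      where
      at-product : sumFin (λ i → (c i * χ i y) * χ i x) ≡ 0#
      at-product = trans (sumFin-cong {suc m} (λ i → trans (*-assoc (c i) _ _) (cong (c i *_) (sym (χ-mul i y x)))))
                         (relation (y * x))
      scaled : sumFin (λ i → (χ Fin.zero y * c i) * χ i x) ≡ 0#
      scaled = begin
        sumFin (λ i → (χ Fin.zero y * c i) * χ i x)  ≡⟨ sumFin-cong {suc m} (λ i → *-assoc (χ Fin.zero y) (c i) (χ i x)) ⟩
        sumFin (λ i → χ Fin.zero y * (c i * χ i x))  ≡⟨ sym (sumFin-scale (χ Fin.zero y) (λ i → c i * χ i x)) ⟩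
        χ Fin.zero y * sumFin (λ i → c i * χ i x)    ≡⟨ cong (χ Fin.zero y *_) (relation x) ⟩
        χ Fin.zero y * 0#                            ≡⟨ zeroʳ _ ⟩
        0#                                           ∎

    tail-zero : ∀ j → c′ j ≡ 0#
    tail-zero j = scalar-zero (trans (x∙y⁻¹≈ε⇒x≈y _ _ reduced) (*-comm _ (c′ j))) y-separates
      where
      separation : Σ F λ y → χ′ j y ≢ χ Fin.zero y
      separation = χ-distinct (Fin.suc j) Fin.zero (λ ())
      y : F
      y = proj₁ separation
      y-separates : χ′ j y ≢ χ Fin.zero y
      y-separates = proj₂ separation
      reduced : c′ j * χ′ j y + - (χ Fin.zero y * c′ j) ≡ 0#
      reduced = characters-independent (dropFirst X) (λ k → c′ k * χ′ k y + - (χ Fin.zero y * c′ k))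
                  (λ x → combination-difference _ _ (λ k → χ′ k x) (eliminate-χ₀ y x)) j

    coefficient : ∀ i → c i ≡ 0#
    coefficient (Fin.suc j) = tail-zero j
    coefficient Fin.zero = begin
      c Fin.zero                                         ≡⟨ sym (*-identityʳ _) ⟩
      c Fin.zero * 1#                                    ≡⟨ cong (c Fin.zero *_) (sym (χ-one Fin.zero)) ⟩
      c Fin.zero * χ Fin.zero 1#                         ≡⟨ sym (+-identityʳ _) ⟩
      c Fin.zero * χ Fin.zero 1# + 0#                    ≡⟨ cong (_ +_) (sym (sumFin-zero _ (λ j →
                                                             trans (cong (_* χ′ j 1#) (tail-zero j)) (zeroˡ _)))) ⟩
      c Fin.zero * χ Fin.zero 1# + sumFin (λ j → c′ j * χ′ j 1#)  ≡⟨ relation 1# ⟩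
      0#                                                 ∎

  characters-coefficients-unique : ∀ {m} (X : DistinctCharacters m) (a b : Fin m → F) →
    (∀ x → sumFin (λ i → a i * DistinctCharacters.χ X i x) ≡ sumFin (λ i → b i * DistinctCharacters.χ X i x)) →
    ∀ i → a i ≡ b i
  characters-coefficients-unique X a b same i = x∙y⁻¹≈ε⇒x≈y _ _
    (characters-independent X (λ k → a k + - b k)
       (λ x → combination-difference a b (λ k → DistinctCharacters.χ X k x) (same x)) i)

module Frobenius (q n : ℕ) (1<q : 1 < q) (K : FiniteField (q ℕ.^ n)) where
  open FiniteField K
  open FieldFacts K
  open ≡-Reasoning

  instance
    q-nonZero : ℕ.NonZero q
    q-nonZero = ℕ.>-nonZero (ℕP.<-trans (s≤s z≤n) 1<q)

  Φ : ℕ → F → F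
  Φ e x = pow x (q ℕ.^ e)

  Φ-+ : ∀ i j x → Φ (i ℕ.+ j) x ≡ Φ j (Φ i x)
  Φ-+ i j x = trans (cong (pow x) (ℕP.^-distribˡ-+-* q i j)) (pow-* x (q ℕ.^ i) (q ℕ.^ j))

  Φ-mul : ∀ e x y → Φ e (x * y) ≡ Φ e x * Φ e y
  Φ-mul e x y = pow-*-distrib x y (q ℕ.^ e)

  Φ-one : ∀ e → Φ e 1# ≡ 1#
  Φ-one e = pow-1# (q ℕ.^ e)

  Φ-0# : ∀ e → Φ e 0# ≡ 0#
  Φ-0# e = pow-0# (q ℕ.^ e) (ℕP.m^n>0 q e)

  Φ-exponent-0 : ∀ x → Φ 0 x ≡ x
  Φ-exponent-0 x = *-identityʳ x

  Φ-n : ∀ x → Φ n x ≡ x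
  Φ-n = fermat

  -- Φ₀, …, Φ_{n-1} are pairwise distinct: if Φᵢ = Φⱼ with i < j < n, then
  -- x^(q^i) = x^(q^j) holds on all q^n elements, although q^j < q^n.
  Φ-exponent-unique : ∀ {i j} → i < n → j < n → (∀ x → Φ i x ≡ Φ j x) → i ≡ j
  Φ-exponent-unique {i} {j} i<n j<n Φi≗Φj with ℕP.<-cmp i j
  ... | tri≈ _ i≡j _ = i≡j
  ... | tri< i<j _ _ = ⊥-elim (ℕP.<⇒≱ (ℕP.^-monoʳ-< q 1<q j<n)
                          (powers-coincide-bound _ _ (ℕP.^-monoʳ-< q 1<q i<j) Φi≗Φj))
  ... | tri> _ _ j<i = ⊥-elim (ℕP.<⇒≱ (ℕP.^-monoʳ-< q 1<q i<n)
                          (powers-coincide-bound _ _ (ℕP.^-monoʳ-< q 1<q j<i) (λ x → sym (Φi≗Φj x))))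

  Φ-identity-exponent : ∀ m → m < n ℕ.+ n → (∀ x → Φ m x ≡ x) → m ≡ 0 ⊎ m ≡ n
  Φ-identity-exponent m m<2n Φm≗id with m ℕ.<? n
  ... | yes m<n = inj₁ (Φ-exponent-unique m<n (ℕP.≤-<-trans z≤n m<n) (λ x → trans (Φm≗id x) (sym (Φ-exponent-0 x))))
  ... | no  m≮n = inj₂ (begin
      m                ≡⟨ sym (ℕP.m+[n∸m]≡n n≤m) ⟩
      n ℕ.+ (m ℕ.∸ n)  ≡⟨ cong (n ℕ.+_) (Φ-exponent-unique k<n (ℕP.≤-<-trans z≤n k<n) Φk≗Φ0) ⟩
      n ℕ.+ 0          ≡⟨ ℕP.+-identityʳ n ⟩
      n                ∎)
    where
    n≤m : n ≤ m
    n≤m = ℕP.≮⇒≥ m≮n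
    k : ℕ
    k = m ℕ.∸ n
    k<n : k < n
    k<n = ℕP.+-cancelˡ-< n k n (subst (_< n ℕ.+ n) (sym (ℕP.m+[n∸m]≡n n≤m)) m<2n)
    Φk≗Φ0 : ∀ x → Φ k x ≡ Φ 0 x
    Φk≗Φ0 x = begin
      Φ k x            ≡⟨ cong (Φ k) (sym (Φ-n x)) ⟩
      Φ k (Φ n x)      ≡⟨ sym (Φ-+ n k x) ⟩
      Φ (n ℕ.+ k) x    ≡⟨ cong (λ e → Φ e x) (ℕP.m+[n∸m]≡n n≤m) ⟩
      Φ m x            ≡⟨ Φm≗id x ⟩
      x                ≡⟨ sym (Φ-exponent-0 x) ⟩
      Φ 0 x            ∎

  frobenius-characters : DistinctCharacters n
  frobenius-characters = record
    { χ          = λ i → Φ (toℕ i)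
    ; χ-mul      = λ i → Φ-mul (toℕ i)
    ; χ-one      = λ i → Φ-one (toℕ i)
    ; χ-distinct = separating-point
    }
    where
    separating-point : ∀ i j → i ≢ j → Σ F λ y → Φ (toℕ i) y ≢ Φ (toℕ j) y
    separating-point i j i≢j = enum (proj₁ witness) , proj₂ witness
      where
      witness : Σ (Fin (q ℕ.^ n)) λ k → Φ (toℕ i) (enum k) ≢ Φ (toℕ j) (enum k)
      witness = FinP.¬∀⟶∃¬ (q ℕ.^ n) (λ k → Φ (toℕ i) (enum k) ≡ Φ (toℕ j) (enum k))
                  (λ k → Φ (toℕ i) (enum k) ≟ Φ (toℕ j) (enum k))
                  (λ agree → i≢j (FinP.toℕ-injective (Φ-exponent-unique (FinP.toℕ<n i) (FinP.toℕ<n j)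
                     (λ x → subst (λ y → Φ (toℕ i) y ≡ Φ (toℕ j) y) (enum-index x) (agree (index x))))))

  evalQ-monomial : ∀ (L : Vec F n) r c → IsMonomial L r c → ∀ x → evalQ q L x ≡ c * Φ (toℕ r) x
  evalQ-monomial L r c monomial x =
    trans (sumFin-single _ r (λ i i≢r → trans (cong (_* Φ (toℕ i) x) (proj₂ (monomial i) i≢r)) (zeroˡ _)))
          (cong (_* Φ (toℕ r) x) (proj₁ (monomial r) refl))

  ScalingHomogeneous : (F → F) → Set
  ScalingHomogeneous f = ∀ t → Σ F λ A → ∀ y → f (t * y) ≡ A * f y

  NonzeroMonomial : Vec F n → Set
  NonzeroMonomial L = Σ (Fin n) λ r → lookup L r ≢ 0# × IsMonomial L r (lookup L r)

  -- A nonzero q-polynomial L that is homogeneous under scaling,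
  -- L(t · y) = A_t · L(y), is a monomial: comparing the coefficients of
  -- L(t · y) = Σ Lᵢ Φᵢ(t) Φᵢ(y) and A_t · L(y) gives Lᵢ Φᵢ(t) = A_t Lᵢ, so
  -- all nonzero coefficients Lᵢ have the same Φᵢ = A.
  scaling-homogeneous⇒monomial : (L : Vec F n) → ScalingHomogeneous (evalQ q L) →
    (Σ F λ y → evalQ q L y ≢ 0#) → NonzeroMonomial L
  scaling-homogeneous⇒monomial L homogeneous (y₀ , Ly₀≢0) = r , Lr≢0 , monomial
    where
    open DistinctCharacters frobenius-characters using (χ; χ-mul)
    ℓ : Fin n → F
    ℓ = lookup L
    A : F → F
    A t = proj₁ (homogeneous t)

    coefficients : ∀ t i → ℓ i * χ i t ≡ A t * ℓ i
    coefficients t = characters-coefficients-unique frobenius-characters _ _ λ y → begin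
      sumFin (λ i → (ℓ i * χ i t) * χ i y)   ≡⟨ sumFin-cong (λ i → trans (*-assoc (ℓ i) _ _) (cong (ℓ i *_) (sym (χ-mul i t y)))) ⟩
      evalQ q L (t * y)                      ≡⟨ proj₂ (homogeneous t) y ⟩
      A t * evalQ q L y                      ≡⟨ sumFin-scale (A t) (λ i → ℓ i * χ i y) ⟩
      sumFin (λ i → A t * (ℓ i * χ i y))     ≡⟨ sumFin-cong (λ i → sym (*-assoc (A t) (ℓ i) _)) ⟩
      sumFin (λ i → (A t * ℓ i) * χ i y)     ∎

    nonzero-coefficient : Σ (Fin n) λ r → ℓ r ≢ 0#
    nonzero-coefficient = FinP.¬∀⟶∃¬ n (λ i → ℓ i ≡ 0#) (λ i → ℓ i ≟ 0#)
      (λ all-zero → Ly₀≢0 (sumFin-zero _ (λ i → trans (cong (_* χ i y₀) (all-zero i)) (zeroˡ _))))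
    r : Fin n
    r = proj₁ nonzero-coefficient
    Lr≢0 : ℓ r ≢ 0#
    Lr≢0 = proj₂ nonzero-coefficient

    A≗χr : ∀ t → A t ≡ χ r t
    A≗χr t = sym (*-cancelˡ Lr≢0 (trans (coefficients t r) (*-comm (A t) (ℓ r))))

    only-r : ∀ i → ℓ i ≢ 0# → i ≡ r
    only-r i ℓi≢0 = FinP.toℕ-injective (Φ-exponent-unique (FinP.toℕ<n i) (FinP.toℕ<n r)
      (λ t → *-cancelˡ ℓi≢0 (trans (coefficients t i) (trans (*-comm (A t) (ℓ i)) (cong (ℓ i *_) (A≗χr t))))))

    monomial : IsMonomial L r (ℓ r)
    monomial i = cong ℓ , vanishes
      where
      vanishes : i ≢ r → ℓ i ≡ 0#
      vanishes i≢r with ℓ i ≟ 0#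
      ... | yes ℓi≡0 = ℓi≡0
      ... | no  ℓi≢0 = ⊥-elim (i≢r (only-r i ℓi≢0))

  module Composition
    (L₁ L₂ : Vec F n) (L₁-bij : IsPermQPoly q L₁) (L₂-bij : IsPermQPoly q L₂)
    (ρ : F → F) (ρ-surj : Surjective _≡_ _≡_ ρ)
    (scalar⇒composite : ∀ a → Σ F λ b → ∀ x → a * x ≡ evalQ q L₁ (ρ b * evalQ q L₂ x))
    (composite⇒scalar : ∀ b → Σ F λ a → ∀ x → a * x ≡ evalQ q L₁ (ρ b * evalQ q L₂ x))
    where

    f₁ f₂ : F → F
    f₁ = evalQ q L₁
    f₂ = evalQ q L₂

    preimage : ∀ {g : F → F} → Surjective _≡_ _≡_ g → ∀ y → Σ F λ x → g x ≡ y
    preimage g-surj y = proj₁ (g-surj y) , proj₂ (g-surj y) refl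

    β : F
    β = ρ (proj₁ (scalar⇒composite 1#))

    f₁-β-f₂ : ∀ x → f₁ (β * f₂ x) ≡ x
    f₁-β-f₂ x = trans (sym (proj₂ (scalar⇒composite 1#) x)) (*-identityˡ x)

    β≢0 : β ≢ 0#
    β≢0 β≡0 = 0≢1 (begin
      0#                 ≡⟨ sym (sumFin-zero _ (λ i → trans (cong (lookup L₁ i *_) (Φ-0# (toℕ i))) (zeroʳ _))) ⟩
      f₁ 0#              ≡⟨ cong f₁ (sym (trans (cong (_* f₂ 1#) β≡0) (zeroˡ _))) ⟩
      f₁ (β * f₂ 1#)     ≡⟨ f₁-β-f₂ 1# ⟩
      1#                 ∎)

    β⁻¹ : F
    β⁻¹ = inv β β≢0

    -- Scaling the argument of f₁ by t scales its value: choosing b with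
    -- ρ(b) = t β, the map y = β f₂(x) ↦ f₁(t y) is a multiplication.
    f₁-homogeneous : ScalingHomogeneous f₁
    f₁-homogeneous t = A , scaled
      where
      b : F
      b = proj₁ (preimage ρ-surj (t * β))
      ρb≡tβ : ρ b ≡ t * β
      ρb≡tβ = proj₂ (preimage ρ-surj (t * β))
      A : F
      A = proj₁ (composite⇒scalar b)
      scaled : ∀ y → f₁ (t * y) ≡ A * f₁ y
      scaled y = begin
        f₁ (t * y)              ≡⟨ cong (λ z → f₁ (t * z)) (sym βf₂x≡y) ⟩
        f₁ (t * (β * f₂ x))     ≡⟨ cong f₁ (trans (sym (*-assoc t β (f₂ x))) (cong (_* f₂ x) (sym ρb≡tβ))) ⟩
        f₁ (ρ b * f₂ x)         ≡⟨ sym (proj₂ (composite⇒scalar b) x) ⟩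
        A * x                   ≡⟨ cong (A *_) (sym (trans (cong f₁ (sym βf₂x≡y)) (f₁-β-f₂ x))) ⟩
        A * f₁ y                ∎
        where
        x : F
        x = proj₁ (preimage (proj₂ L₂-bij) (β⁻¹ * y))
        βf₂x≡y : β * f₂ x ≡ y
        βf₂x≡y = trans (cong (β *_) (proj₂ (preimage (proj₂ L₂-bij) (β⁻¹ * y)))) (inv-cancelʳ β β≢0 y)

    -- Scaling the argument of f₂ by s scales its value: f₁ is injective and
    -- f₁(β f₂(s x)) = s x = f₁(ρ(b) f₂(x)) for the b attached to s.
    f₂-homogeneous : ScalingHomogeneous f₂
    f₂-homogeneous s = β⁻¹ * ρ b , scaled
      where
      b : F
      b = proj₁ (scalar⇒composite s)
      scaled : ∀ x → f₂ (s * x) ≡ (β⁻¹ * ρ b) * f₂ x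
      scaled x = begin
        f₂ (s * x)                 ≡⟨ sym (inv-cancelˡ β β≢0 _) ⟩
        β⁻¹ * (β * f₂ (s * x))     ≡⟨ cong (β⁻¹ *_) (proj₁ L₁-bij (trans (f₁-β-f₂ (s * x)) (proj₂ (scalar⇒composite s) x))) ⟩
        β⁻¹ * (ρ b * f₂ x)         ≡⟨ sym (*-assoc β⁻¹ (ρ b) (f₂ x)) ⟩
        (β⁻¹ * ρ b) * f₂ x         ∎

    nonzero-value : ∀ {g : F → F} → Bijective _≡_ _≡_ g → Σ F λ y → g y ≢ 0#
    nonzero-value g-bij = proj₁ (preimage (proj₂ g-bij) 1#) ,
      λ gy≡0 → 0≢1 (trans (sym gy≡0) (proj₂ (preimage (proj₂ g-bij) 1#)))

    monomial₁ : NonzeroMonomial L₁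
    monomial₁ = scaling-homogeneous⇒monomial L₁ f₁-homogeneous (nonzero-value L₁-bij)
    monomial₂ : NonzeroMonomial L₂
    monomial₂ = scaling-homogeneous⇒monomial L₂ f₂-homogeneous (nonzero-value L₂-bij)

    r₁ r₂ : Fin n
    r₁ = proj₁ monomial₁
    r₂ = proj₁ monomial₂
    c d : F
    c = lookup L₁ r₁
    d = lookup L₂ r₂

    composite-formula : ∀ x → x ≡ (c * Φ (toℕ r₁) (β * d)) * Φ (toℕ r₂ ℕ.+ toℕ r₁) x
    composite-formula x = begin
      x                                            ≡⟨ sym (f₁-β-f₂ x) ⟩
      f₁ (β * f₂ x)                                ≡⟨ evalQ-monomial L₁ r₁ c (proj₂ (proj₂ monomial₁)) _ ⟩
      c * Φ (toℕ r₁) (β * f₂ x)                    ≡⟨ cong (λ z → c * Φ (toℕ r₁) (β * z))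
                                                        (evalQ-monomial L₂ r₂ d (proj₂ (proj₂ monomial₂)) x) ⟩
      c * Φ (toℕ r₁) (β * (d * Φ (toℕ r₂) x))      ≡⟨ cong (λ z → c * Φ (toℕ r₁) z) (sym (*-assoc β d _)) ⟩
      c * Φ (toℕ r₁) ((β * d) * Φ (toℕ r₂) x)      ≡⟨ cong (c *_) (Φ-mul (toℕ r₁) (β * d) _) ⟩
      c * (Φ (toℕ r₁) (β * d) * Φ (toℕ r₁) (Φ (toℕ r₂) x))
                                                   ≡⟨ sym (*-assoc c _ _) ⟩
      (c * Φ (toℕ r₁) (β * d)) * Φ (toℕ r₁) (Φ (toℕ r₂) x)
                                                   ≡⟨ cong (_ *_) (sym (Φ-+ (toℕ r₂) (toℕ r₁) x)) ⟩
      (c * Φ (toℕ r₁) (β * d)) * Φ (toℕ r₂ ℕ.+ toℕ r₁) x ∎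

    -- At x = 1# the constant is 1#, so Φ_{r₂+r₁} is the identity.
    Φ-r₂+r₁-identity : ∀ x → Φ (toℕ r₂ ℕ.+ toℕ r₁) x ≡ x
    Φ-r₂+r₁-identity x = begin
      Φ e x         ≡⟨ sym (*-identityˡ _) ⟩
      1# * Φ e x    ≡⟨ cong (_* Φ e x) 1≡C ⟩
      C * Φ e x     ≡⟨ sym (composite-formula x) ⟩
      x             ∎
      where
      e : ℕ
      e = toℕ r₂ ℕ.+ toℕ r₁
      C : F
      C = c * Φ (toℕ r₁) (β * d)
      1≡C : 1# ≡ C
      1≡C = trans (composite-formula 1#) (trans (cong (C *_) (Φ-one e)) (*-identityʳ C))

    exponents-complementary : toℕ r₂ ℕ.+ toℕ r₁ ≡ 0 ⊎ toℕ r₂ ℕ.+ toℕ r₁ ≡ n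
    exponents-complementary = Φ-identity-exponent _
      (ℕP.+-mono-< (FinP.toℕ<n r₂) (FinP.toℕ<n r₁)) Φ-r₂+r₁-identity

negFin-complement : ∀ {n} (r s : Fin n) → toℕ s ℕ.+ toℕ r ≡ 0 ⊎ toℕ s ℕ.+ toℕ r ≡ n → negFin r ≡ s
negFin-complement {suc m} r s (inj₁ s+r≡0) = FinP.toℕ-injective (begin
  toℕ (negFin r)                ≡⟨ FinP.toℕ-fromℕ< _ ⟩
  (suc m ℕ.∸ toℕ r) ℕ.% suc m   ≡⟨ cong (λ e → (suc m ℕ.∸ e) ℕ.% suc m) (ℕP.m+n≡0⇒n≡0 (toℕ s) s+r≡0) ⟩
  suc m ℕ.% suc m               ≡⟨ n%n≡0 (suc m) ⟩
  0                             ≡⟨ sym (ℕP.m+n≡0⇒m≡0 (toℕ s) s+r≡0) ⟩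
  toℕ s                         ∎)
  where open ≡-Reasoning
negFin-complement {suc m} r s (inj₂ s+r≡n) = FinP.toℕ-injective (begin
  toℕ (negFin r)                          ≡⟨ FinP.toℕ-fromℕ< _ ⟩
  (suc m ℕ.∸ toℕ r) ℕ.% suc m             ≡⟨ cong (λ e → (e ℕ.∸ toℕ r) ℕ.% suc m) (sym s+r≡n) ⟩
  (toℕ s ℕ.+ toℕ r ℕ.∸ toℕ r) ℕ.% suc m   ≡⟨ cong (ℕ._% suc m) (ℕP.m+n∸n≡m (toℕ s) (toℕ r)) ⟩
  toℕ s ℕ.% suc m                         ≡⟨ m<n⇒m%n≡m (FinP.toℕ<n s) ⟩
  toℕ s                                   ∎)
  where open ≡-Reasoning

prime-power>1 : ∀ {q} → IsPrimePower q → 1 < q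
prime-power>1 (p , k , p-prime , k≥1 , refl) =
  ℕP.<-≤-trans (ℕ.nonTrivial⇒n>1 p {{prime⇒nonTrivial p-prime}})
    (subst (ℕ._≤ p ℕ.^ k) (ℕP.*-identityʳ p) (ℕP.^-monoʳ-≤ p {1} {k} k≥1))
  where
  instance
    p-nonZero : ℕ.NonZero p
    p-nonZero = prime⇒nonZero p-prime

lemma4p6 : (q n : ℕ) → IsPrimePower q → n ≥ 1 →
    (K : FiniteField (q ^ n)) →
    let open FiniteField K in
    (L₁ L₂ : Vec F n) → IsPermQPoly q L₁ → IsPermQPoly q L₂ →
    (ρ : F → F) → IsAutomorphism ρ →
    (∀ a → Σ F λ b → ∀ x → a * x ≡ evalQ q L₁ (ρ b * evalQ q L₂ x)) →
    (∀ b → Σ F λ a → ∀ x → a * x ≡ evalQ q L₁ (ρ b * evalQ q L₂ x)) →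
    Σ (Fin n) λ r → Σ F λ c → Σ F λ d →
      c ≢ 0# × d ≢ 0# × IsMonomial L₁ r c ×
      IsMonomial L₂ (negFin r) d
lemma4p6 q n q-prime-power _ K L₁ L₂ L₁-bij L₂-bij ρ (ρ-bij , _) scalar⇒composite composite⇒scalar =
  r₁ , c , d , proj₁ (proj₂ monomial₁) , proj₁ (proj₂ monomial₂) , proj₂ (proj₂ monomial₁) ,
  subst (λ r → IsMonomial L₂ r d) (sym (negFin-complement r₁ r₂ exponents-complementary)) (proj₂ (proj₂ monomial₂))
  where
  open FiniteField K using (IsMonomial)
  open Frobenius q n (prime-power>1 q-prime-power) K
  open Composition L₁ L₂ L₁-bij L₂-bij ρ (proj₂ ρ-bij) scalar⇒composite composite⇒scalar
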